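{- Let $\beta \in \mathbb{C} \setminus \mathbb{R}$ be a root of a quadratic polynomial with integer coefficients. Then $0$ has a nontrivial partition into non-negative powers of $\beta$ (i.e. there is a nonzero polynomial $f \in \mathbb{Z}_{\geq 0}[x]$ with $f(\beta) = 0$), so that $p_\beta(0) = \infty$. Consequently $p_\beta(\alpha) \in \{0, \infty\}$ for every $\alpha \in \mathbb{C}$.
   Context: For $\beta, \alpha \in \mathbb{C}$, $p_\beta(\alpha) \in \mathbb{Z}_{\geq 0}\cup\{\infty\}$ denotes the number of expressions $\alpha = a_j\beta^j + \dots + a_1\beta + a_0$ with $j, a_i \in \mathbb{Z}_{\geq 0}$ and $a_j \neq 0$; equivalently, the number of polynomials $f(x) \in \mathbb{Z}_{\geq 0}[x]$ with $f(\beta) = \alpha$. -}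

module Defs where

open import Level using (Level; _⊔_)
open import Algebra.Bundles using (CommutativeRing)
open import Data.Nat using (ℕ; zero; suc)
open import Data.Integer using (ℤ; +_; -[1+_])
open import Data.List using (List; []; _∷_)
open import Data.Product using (Σ; _×_)
open import Data.Empty using (⊥)
open import Relation.Binary.PropositionalEquality using (_≡_; _≢_)

-- Polynomials in ℤ≥0[x] are represented by coefficient lists
-- (a₀ ∷ a₁ ∷ … ∷ aⱼ ∷ []), constant term first.

LeadingNonZero : List ℕ → Set
LeadingNonZero []           = ⊥
LeadingNonZero (a ∷ [])     = a ≢ 0
LeadingNonZero (a ∷ b ∷ as) = LeadingNonZero (b ∷ as)

module _ {c ℓ : Level} (R : CommutativeRing c ℓ) where
  open CommutativeRing R

  natR : ℕ → Carrier
  natR zero    = 0#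
  natR (suc n) = 1# + natR n

  intR : ℤ → Carrier
  intR (+ n)      = natR n
  intR -[1+ n ]   = - natR (suc n)

  eval : Carrier → List ℕ → Carrier
  eval β []       = 0#
  eval β (a ∷ as) = natR a + β * eval β as

  Rep : Carrier → Carrier → List ℕ → Set ℓ
  Rep β α f = LeadingNonZero f × (eval β f ≈ α)

  IsRoot : ℤ → ℤ → ℤ → Carrier → Set ℓ
  IsRoot a b c' β = (intR a * (β * β) + intR b * β) + intR c' ≈ 0#

InfinitelyMany : {p : Level} → (List ℕ → Set p) → Set p
InfinitelyMany P =
  Σ (ℕ → List ℕ) λ g → ((n : ℕ) → P (g n)) × ((m n : ℕ) → g m ≡ g n → m ≡ n)

{-# OPTIONS --safe #-}
module Submission where

-- Normalise to a > 0; then the negative discriminant forces c > 0. If b ≥ 0, the polynomial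
-- c + b x + a x² itself vanishes at β. Otherwise write b = −M, so a γ² + c = M γ for γ = β.
-- Squaring gives a² δ² + (2ac − M²) δ + c² = 0 for δ = γ². If M² ≤ 2ac all coefficients are
-- nonnegative and we are done; otherwise this is a relation a² δ² + c² = M′ δ of the same shape,
-- with M′ = M² − 2ac and discriminant 4a²c² − M′² = M²(4ac − M²). Writing β = r e^{iθ}, one has
-- cos² θ = M²/4ac and squaring doubles θ; the ratio 4ac/(4ac − M²) = 1/sin² θ at least halves
-- while M² > 2ac, so the process stops after finitely many squarings. A polynomial vanishing at
-- β^(2^k) yields one vanishing at β by substituting x ↦ x^(2^k). Appending copies of the
-- coefficient list of a vanishing polynomial to a representation of α gives infinitely many.

open import Defs
open import Level using (Level)
open import Algebra.Bundles using (CommutativeRing)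
open import Data.Nat as ℕ using (ℕ; zero; suc; NonZero)
open import Data.List using (List; []; _∷_; _++_; length)
open import Data.Product using (Σ; _×_; _,_; proj₂)
open import Data.Empty using (⊥-elim)
open import Relation.Nullary using (yes; no; contradiction)
open import Relation.Binary.PropositionalEquality using (_≡_; _≢_)
import Relation.Binary.PropositionalEquality as ≡

LeadingNonZero-∷ : ∀ x xs → LeadingNonZero xs → LeadingNonZero (x ∷ xs)
LeadingNonZero-∷ x []      ()
LeadingNonZero-∷ x (_ ∷ _) lnz = lnz

LeadingNonZero-++ : ∀ xs ys → LeadingNonZero ys → LeadingNonZero (xs ++ ys)
LeadingNonZero-++ []       ys lnz = lnz
LeadingNonZero-++ (x ∷ xs) ys lnz = LeadingNonZero-∷ x (xs ++ ys) (LeadingNonZero-++ xs ys lnz)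

dilate : List ℕ → List ℕ
dilate []           = []
dilate (a ∷ [])     = a ∷ []
dilate (a ∷ b ∷ bs) = a ∷ 0 ∷ dilate (b ∷ bs)

LeadingNonZero-dilate : ∀ f → LeadingNonZero f → LeadingNonZero (dilate f)
LeadingNonZero-dilate []           ()
LeadingNonZero-dilate (a ∷ [])     lnz = lnz
LeadingNonZero-dilate (a ∷ b ∷ bs) lnz =
  LeadingNonZero-∷ 0 (dilate (b ∷ bs)) (LeadingNonZero-dilate (b ∷ bs) lnz)

module _ where
  open ≡
  open import Data.Nat
  open import Data.Nat.Properties
  open import Data.List.Properties using (length-++)
  open import Data.Nat.Tactic.RingSolver using (solve; solve-∀)

  pump : List ℕ → List ℕ → ℕ → List ℕ
  pump f h zero    = f
  pump f h (suc n) = pump f h n ++ h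

  length-pump : ∀ f h n → length (pump f h n) ≡ length f + n * length h
  length-pump f h zero    = sym (+-identityʳ (length f))
  length-pump f h (suc n) = begin
    length (pump f h n ++ h)                   ≡⟨ length-++ (pump f h n) ⟩
    length (pump f h n) + length h             ≡⟨ cong (_+ length h) (length-pump f h n) ⟩
    length f + n * length h + length h         ≡⟨ +-assoc (length f) _ _ ⟩
    length f + (n * length h + length h)       ≡⟨ cong (length f +_) (+-comm (n * length h) _) ⟩
    length f + (length h + n * length h)       ∎
    where open ≡-Reasoning

  pump-injective : ∀ f h .{{_ : NonZero (length h)}} m n → pump f h m ≡ pump f h n → m ≡ n
  pump-injective f h m n eq = *-cancelʳ-≡ m n (length h) (+-cancelˡ-≡ (length f) _ _ (begin
    length f + m * length h  ≡⟨ length-pump f h m ⟨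
    length (pump f h m)      ≡⟨ cong length eq ⟩
    length (pump f h n)      ≡⟨ length-pump f h n ⟩
    length f + n * length h  ∎))
    where open ≡-Reasoning

  n≤2^n : ∀ n → n ≤ 2 ^ n
  n≤2^n zero    = z≤n
  n≤2^n (suc n) = +-mono-≤ (m^n>0 2 n) (≤-trans (n≤2^n n) (m≤m+n (2 ^ n) 0))

  discriminant-square : ∀ A C M M′ D → D + M * M ≡ 4 * A * C → M′ + 2 * A * C ≡ M * M →
                        M * M * D + M′ * M′ ≡ 4 * (A * A) * (C * C)
  discriminant-square A C M M′ D disc split = begin
    M * M * D + M′ * M′            ≡⟨ cong (λ k → k * D + M′ * M′) split ⟨
    (M′ + 2 * A * C) * D + M′ * M′ ≡⟨ cong (λ k → (M′ + k) * D + M′ * M′) half ⟨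
    (M′ + (D + M′)) * D + M′ * M′  ≡⟨ solve (M′ ∷ D ∷ []) ⟩
    (D + M′) * (D + M′)            ≡⟨ cong (λ k → k * k) half ⟩
    2 * A * C * (2 * A * C)        ≡⟨ solve (A ∷ C ∷ []) ⟩
    4 * (A * A) * (C * C)          ∎
    where
    open ≡-Reasoning
    half : D + M′ ≡ 2 * A * C
    half = +-cancelʳ-≡ (2 * A * C) (D + M′) (2 * A * C) (begin
      D + M′ + 2 * A * C     ≡⟨ +-assoc D M′ _ ⟩
      D + (M′ + 2 * A * C)   ≡⟨ cong (D +_) split ⟩
      D + M * M              ≡⟨ disc ⟩
      4 * A * C              ≡⟨ solve (A ∷ C ∷ []) ⟩
      2 * A * C + 2 * A * C  ∎)

  bound-halves : ∀ A C M D f → 4 * A * C ≤ D * 2 ^ suc f → 2 * A * C < M * M →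
                 4 * (A * A) * (C * C) ≤ M * M * D * 2 ^ f
  bound-halves A C M D f bound large = begin
    4 * (A * A) * (C * C)    ≡⟨ solve (A ∷ C ∷ []) ⟩
    A * C * (4 * A * C)      ≤⟨ *-monoʳ-≤ (A * C) bound ⟩
    A * C * (D * 2 ^ suc f)  ≡⟨ regroup A C D (2 ^ f) ⟩
    2 * A * C * D * 2 ^ f    ≤⟨ *-monoˡ-≤ (2 ^ f) (*-monoˡ-≤ D (<⇒≤ large)) ⟩
    M * M * D * 2 ^ f        ∎
    where
    open ≤-Reasoning
    regroup : ∀ a c d t → a * c * (d * (2 * t)) ≡ 2 * a * c * d * t
    regroup = solve-∀

  bound-exhausted : ∀ {D X N} → D + X ≡ N → N ≤ D * 2 ^ 0 → X ≤ 0
  bound-exhausted {D} {X} {N} disc bound = +-cancelˡ-≤ D X 0 (begin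
    D + X  ≡⟨ disc ⟩
    N      ≤⟨ bound ⟩
    D * 1  ≡⟨ *-identityʳ D ⟩
    D      ≡⟨ +-identityʳ D ⟨
    D + 0  ∎)
    where open ≤-Reasoning

open import Data.Integer as ℤ using (ℤ; +_; -[1+_]; +[1+_])

module _ {r ℓ : Level} (R : CommutativeRing r ℓ) where
  open CommutativeRing R
  open import Algebra.Properties.Ring ring
    using (-‿distribˡ-*; -‿+-comm; -0#≈0#; -‿involutive; +-cancelʳ; x∙y⁻¹≈ε⇒x≈y)
  open import Algebra.Properties.Semiring.Mult semiring
    using (×-homo-+; ×1-homo-*) renaming (_×_ to _·_)
  open import Algebra.Solver.Ring.NaturalCoefficients.Default commutativeSemiring
  open import Relation.Binary.Reasoning.Setoid setoid
  open import Data.Nat.Properties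
    using (_≤?_; ≤-trans; <⇒≤; ≰⇒>; m∸n+n≡m; m<n⇒0<n∸m; m*n≢0; m≤n*m)

  natR≡·1# : ∀ n → natR R n ≡ n · 1#
  natR≡·1# zero    = ≡.refl
  natR≡·1# (suc n) = ≡.cong (λ x → 1# + x) (natR≡·1# n)

  natR-+ : ∀ m n → natR R (m ℕ.+ n) ≈ natR R m + natR R n
  natR-+ m n = begin
    natR R (m ℕ.+ n)     ≡⟨ natR≡·1# (m ℕ.+ n) ⟩
    (m ℕ.+ n) · 1#       ≈⟨ ×-homo-+ 1# m n ⟩
    m · 1# + n · 1#      ≡⟨ ≡.cong₂ _+_ (natR≡·1# m) (natR≡·1# n) ⟨
    natR R m + natR R n  ∎

  natR-* : ∀ m n → natR R (m ℕ.* n) ≈ natR R m * natR R n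
  natR-* m n = begin
    natR R (m ℕ.* n)     ≡⟨ natR≡·1# (m ℕ.* n) ⟩
    (m ℕ.* n) · 1#       ≈⟨ ×1-homo-* m n ⟩
    m · 1# * n · 1#      ≡⟨ ≡.cong₂ _*_ (natR≡·1# m) (natR≡·1# n) ⟨
    natR R m * natR R n  ∎

  natR-2*m*n : ∀ m n → natR R (2 ℕ.* m ℕ.* n) ≈ natR R m * natR R n + natR R m * natR R n
  natR-2*m*n m n = begin  -- natR R 2 unfolds to 1# + (1# + 0#)
    natR R (2 ℕ.* m ℕ.* n)           ≈⟨ trans (natR-* (2 ℕ.* m) n) (*-congʳ (natR-* 2 m)) ⟩
    natR R 2 * natR R m * natR R n   ≈⟨ solve 2 (λ x y → (con 1 :+ (con 1 :+ con 0)) :* x :* y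
                                                  := x :* y :+ x :* y) refl (natR R m) (natR R n) ⟩
    natR R m * natR R n + natR R m * natR R n ∎

  intR-neg : ∀ i → intR R (ℤ.- i) ≈ - intR R i
  intR-neg (+ zero)   = sym -0#≈0#
  intR-neg +[1+ n ]   = refl
  intR-neg -[1+ n ]   = sym (-‿involutive _)

  IsRoot-neg : ∀ a b c' {γ} → IsRoot R a b c' γ → IsRoot R (ℤ.- a) (ℤ.- b) (ℤ.- c') γ
  IsRoot-neg a b c' {γ} root = begin
    intR R (ℤ.- a) * (γ * γ) + intR R (ℤ.- b) * γ + intR R (ℤ.- c')
      ≈⟨ +-cong (+-cong (*-congʳ (intR-neg a)) (*-congʳ (intR-neg b))) (intR-neg c') ⟩
    - intR R a * (γ * γ) + - intR R b * γ + - intR R c'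
      ≈⟨ +-congʳ (+-cong (-‿distribˡ-* _ _) (-‿distribˡ-* _ _)) ⟨
    - (intR R a * (γ * γ)) + - (intR R b * γ) + - intR R c'
      ≈⟨ trans (+-congʳ (-‿+-comm _ _)) (-‿+-comm _ _) ⟩
    - (intR R a * (γ * γ) + intR R b * γ + intR R c')
      ≈⟨ -‿cong root ⟩
    - 0#
      ≈⟨ -0#≈0# ⟩
    0# ∎

  eval-dilate : ∀ γ f → eval R γ (dilate f) ≈ eval R (γ * γ) f
  eval-dilate γ []           = refl
  eval-dilate γ (a ∷ [])     = +-congˡ (trans (zeroʳ γ) (sym (zeroʳ (γ * γ))))
  eval-dilate γ (a ∷ b ∷ bs) = +-congˡ (begin
    γ * (0# + γ * eval R γ (dilate (b ∷ bs)))  ≈⟨ *-congˡ (+-identityˡ _) ⟩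
    γ * (γ * eval R γ (dilate (b ∷ bs)))       ≈⟨ *-assoc γ γ _ ⟨
    γ * γ * eval R γ (dilate (b ∷ bs))         ≈⟨ *-congˡ (eval-dilate γ (b ∷ bs)) ⟩
    γ * γ * eval R (γ * γ) (b ∷ bs)            ∎)

  Rep-dilate : ∀ {γ α} → Σ (List ℕ) (Rep R (γ * γ) α) → Σ (List ℕ) (Rep R γ α)
  Rep-dilate {γ} (f , lnz , value) =
    dilate f , LeadingNonZero-dilate f lnz , trans (eval-dilate γ f) value

  eval-++-vanishing : ∀ γ xs {ys} → eval R γ ys ≈ 0# → eval R γ (xs ++ ys) ≈ eval R γ xs
  eval-++-vanishing γ []       vanishes = vanishes
  eval-++-vanishing γ (x ∷ xs) vanishes = +-congˡ (*-congˡ (eval-++-vanishing γ xs vanishes))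

  Rep-pump : ∀ {γ α f h} → Rep R γ 0# h → Rep R γ α f → ∀ n → Rep R γ α (pump f h n)
  Rep-pump _ rep zero = rep
  Rep-pump {γ} {f = f} {h} zero-rep@(lnz , vanishes) rep (suc n) =
    LeadingNonZero-++ (pump f h n) h lnz ,
    trans (eval-++-vanishing γ (pump f h n) vanishes) (proj₂ (Rep-pump zero-rep rep n))

  Rep-infinitelyMany : ∀ {γ α} → Σ (List ℕ) (Rep R γ 0#) → Σ (List ℕ) (Rep R γ α) →
                       InfinitelyMany (Rep R γ α)
  Rep-infinitelyMany ([] , () , _)
  Rep-infinitelyMany (h@(_ ∷ _) , zero-rep) (f , rep) =
    pump f h , Rep-pump zero-rep rep , pump-injective f h

  IsRoot⇒vanishing : ∀ A B C {γ} .{{_ : NonZero A}} → IsRoot R (+ A) (+ B) (+ C) γ →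
                     Σ (List ℕ) (Rep R γ 0#)
  IsRoot⇒vanishing A B C {γ} root = C ∷ B ∷ A ∷ [] , ℕ.≢-nonZero⁻¹ A , trans eval-quadratic root
    where
    eval-quadratic : eval R γ (C ∷ B ∷ A ∷ []) ≈ natR R A * (γ * γ) + natR R B * γ + natR R C
    eval-quadratic = solve 4 (λ a b c x → c :+ x :* (b :+ x :* (a :+ x :* con 0))
                                        := a :* (x :* x) :+ b :* x :+ c)
                             refl (natR R A) (natR R B) (natR R C) γ

  record IsRoot⁻ (A M C : ℕ) (γ : Carrier) : Set ℓ where
    constructor isRoot⁻
    field equation : natR R A * (γ * γ) + natR R C ≈ natR R M * γ

  IsRoot⇒IsRoot⁻ : ∀ A m C {γ} → IsRoot R (+ A) -[1+ m ] (+ C) γ → IsRoot⁻ A (suc m) C γ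
  IsRoot⇒IsRoot⁻ A m C {γ} root = isRoot⁻ (x∙y⁻¹≈ε⇒x≈y _ _ (begin
    natR R A * (γ * γ) + natR R C + - (natR R (suc m) * γ)
      ≈⟨ +-congˡ (-‿distribˡ-* _ _) ⟩
    natR R A * (γ * γ) + natR R C + - natR R (suc m) * γ
      ≈⟨ solve 3 (λ x y z → x :+ y :+ z := x :+ z :+ y) refl _ _ _ ⟩
    natR R A * (γ * γ) + - natR R (suc m) * γ + natR R C
      ≈⟨ root ⟩
    0# ∎))

  IsRoot⁻-square : ∀ {A M C γ} → IsRoot⁻ A M C γ →
    natR R (A ℕ.* A) * ((γ * γ) * (γ * γ)) + natR R (2 ℕ.* A ℕ.* C) * (γ * γ) + natR R (C ℕ.* C)
      ≈ natR R (M ℕ.* M) * (γ * γ)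
  IsRoot⁻-square {A} {M} {C} {γ} (isRoot⁻ root) = begin
    natR R (A ℕ.* A) * ((γ * γ) * (γ * γ)) + natR R (2 ℕ.* A ℕ.* C) * (γ * γ) + natR R (C ℕ.* C)
      ≈⟨ +-cong (+-cong (*-congʳ (natR-* A A)) (*-congʳ (natR-2*m*n A C))) (natR-* C C) ⟩
    a * a * ((γ * γ) * (γ * γ)) + (a * c + a * c) * (γ * γ) + c * c
      ≈⟨ solve 3 (λ a c x → a :* a :* ((x :* x) :* (x :* x)) :+ (a :* c :+ a :* c) :* (x :* x)
                              :+ c :* c
                          := (a :* (x :* x) :+ c) :* (a :* (x :* x) :+ c)) refl a c γ ⟩
    (a * (γ * γ) + c) * (a * (γ * γ) + c)
      ≈⟨ *-cong root root ⟩
    (m * γ) * (m * γ)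
      ≈⟨ solve 2 (λ m x → (m :* x) :* (m :* x) := m :* m :* (x :* x)) refl m γ ⟩
    m * m * (γ * γ)
      ≈⟨ *-congʳ (natR-* M M) ⟨
    natR R (M ℕ.* M) * (γ * γ) ∎
    where
    a c m : Carrier
    a = natR R A
    c = natR R C
    m = natR R M

  IsRoot⁻-square-stop : ∀ {A M C E γ} → E ℕ.+ M ℕ.* M ≡ 2 ℕ.* A ℕ.* C → IsRoot⁻ A M C γ →
                        IsRoot R (+ (A ℕ.* A)) (+ E) (+ (C ℕ.* C)) (γ * γ)
  IsRoot⁻-square-stop {A} {M} {C} {E} {γ} split root = +-cancelʳ (m² * δ) _ _ (begin
    p + e * δ + q + m² * δ
      ≈⟨ solve 5 (λ p q e m d → p :+ e :* d :+ q :+ m :* d := p :+ (e :+ m) :* d :+ q)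
                 refl p q e m² δ ⟩
    p + (e + m²) * δ + q
      ≈⟨ +-congʳ (+-congˡ (*-congʳ (natR-+ E (M ℕ.* M)))) ⟨
    p + natR R (E ℕ.+ M ℕ.* M) * δ + q
      ≡⟨ ≡.cong (λ k → p + natR R k * δ + q) split ⟩
    p + natR R (2 ℕ.* A ℕ.* C) * δ + q
      ≈⟨ IsRoot⁻-square root ⟩
    m² * δ
      ≈⟨ +-identityˡ (m² * δ) ⟨
    0# + m² * δ ∎)
    where
    δ p q e m² : Carrier
    δ = γ * γ
    p = natR R (A ℕ.* A) * (δ * δ)
    q = natR R (C ℕ.* C)
    e = natR R E
    m² = natR R (M ℕ.* M)

  IsRoot⁻-square-step : ∀ {A M C M′ γ} → M′ ℕ.+ 2 ℕ.* A ℕ.* C ≡ M ℕ.* M → IsRoot⁻ A M C γ →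
                        IsRoot⁻ (A ℕ.* A) M′ (C ℕ.* C) (γ * γ)
  IsRoot⁻-square-step {A} {M} {C} {M′} {γ} split root = isRoot⁻ (+-cancelʳ (k * δ) _ _ (begin
    p + q + k * δ
      ≈⟨ solve 3 (λ p q x → p :+ q :+ x := p :+ x :+ q) refl p q (k * δ) ⟩
    p + k * δ + q
      ≈⟨ IsRoot⁻-square root ⟩
    natR R (M ℕ.* M) * δ
      ≡⟨ ≡.cong (λ n → natR R n * δ) split ⟨
    natR R (M′ ℕ.+ 2 ℕ.* A ℕ.* C) * δ
      ≈⟨ *-congʳ (natR-+ M′ (2 ℕ.* A ℕ.* C)) ⟩
    (m′ + k) * δ
      ≈⟨ distribʳ δ m′ k ⟩
    m′ * δ + k * δ ∎))
    where
    δ p q k m′ : Carrier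
    δ = γ * γ
    p = natR R (A ℕ.* A) * (δ * δ)
    q = natR R (C ℕ.* C)
    k = natR R (2 ℕ.* A ℕ.* C)
    m′ = natR R M′

  -- D is the discriminant 4AC − M², and the bound says that at most fuel + 1 squarings remain.
  vanishing-by-squaring : ∀ fuel A M C D {γ} .{{_ : NonZero A}} → D ℕ.+ M ℕ.* M ≡ 4 ℕ.* A ℕ.* C →
                          4 ℕ.* A ℕ.* C ℕ.≤ D ℕ.* 2 ℕ.^ fuel → IsRoot⁻ A M C γ →
                          Σ (List ℕ) (Rep R γ 0#)
  vanishing-by-squaring fuel A M C D disc bound root with M ℕ.* M ≤? 2 ℕ.* A ℕ.* C | fuel
  ... | yes small | _ =
    Rep-dilate (IsRoot⇒vanishing (A ℕ.* A) (2 ℕ.* A ℕ.* C ℕ.∸ M ℕ.* M) (C ℕ.* C) {{m*n≢0 A A}}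
                                 (IsRoot⁻-square-stop (m∸n+n≡m small) root))
  ... | no large | zero = contradiction (≤-trans (bound-exhausted disc bound) ℕ.z≤n) large
  ... | no large | suc fuel′ =
    Rep-dilate (vanishing-by-squaring fuel′ (A ℕ.* A) M′ (C ℕ.* C) (M ℕ.* M ℕ.* D) {{m*n≢0 A A}}
                          (discriminant-square A C M M′ D disc split)
                          (bound-halves A C M D fuel′ bound (≰⇒> large))
                          (IsRoot⁻-square-step split root))
    where
    M′ : ℕ
    M′ = M ℕ.* M ℕ.∸ 2 ℕ.* A ℕ.* C
    split : M′ ℕ.+ 2 ℕ.* A ℕ.* C ≡ M ℕ.* M
    split = m∸n+n≡m (<⇒≤ (≰⇒> large))

  IsRoot⁻-vanishing : ∀ {A M C γ} .{{_ : NonZero A}} → M ℕ.* M ℕ.< 4 ℕ.* A ℕ.* C →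
                      IsRoot⁻ A M C γ → Σ (List ℕ) (Rep R γ 0#)
  IsRoot⁻-vanishing {A} {M} {C} disc root =
    vanishing-by-squaring N A M C D (m∸n+n≡m (<⇒≤ disc)) bound root
    where
    N D : ℕ
    N = 4 ℕ.* A ℕ.* C
    D = N ℕ.∸ M ℕ.* M
    bound : N ℕ.≤ D ℕ.* 2 ℕ.^ N
    bound = ≤-trans (n≤2^n N) (m≤n*m (2 ℕ.^ N) D {{ℕ.>-nonZero (m<n⇒0<n∸m disc)}})

open import Data.Integer using (_*_; _-_; _<_; _≤_; +≤+; -<+)
open import Data.Integer.Properties
  using (≤-<-trans; <⇒≱; ≰⇒>; <-asym; i≤j⇒0≤j-i; drop‿+<+; pos-*)
open import Data.Integer.Tactic.RingSolver using (solve-∀)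

i-j<0⇒i<j : ∀ {i j} → i - j < + 0 → i < j
i-j<0⇒i<j i-j<0 = ≰⇒> (λ j≤i → <⇒≱ i-j<0 (i≤j⇒0≤j-i j≤i))

0≤i*i : ∀ i → + 0 ≤ i * i
0≤i*i (+ n)    = ≡.subst (+ 0 ≤_) (pos-* n n) (+≤+ ℕ.z≤n)
0≤i*i -[1+ n ] = +≤+ ℕ.z≤n

discriminant-neg : ∀ a b c → ℤ.- b * ℤ.- b - (+ 4 * ℤ.- a) * ℤ.- c ≡ b * b - (+ 4 * a) * c
discriminant-neg = solve-∀

vanishing-positive : ∀ {r ℓ} (R : CommutativeRing r ℓ) A b c {γ} →
                     b * b - (+ 4 * +[1+ A ]) * c < + 0 → IsRoot R +[1+ A ] b c γ →
                     Σ (List ℕ) (Rep R γ (CommutativeRing.0# R))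
vanishing-positive R A b -[1+ _ ] disc root =
  ⊥-elim (<-asym (≤-<-trans (0≤i*i b) (i-j<0⇒i<j disc)) -<+)
vanishing-positive R A (+ B) (+ C) disc root = IsRoot⇒vanishing R (suc A) B C root
vanishing-positive R A -[1+ m ] (+ C) disc root =
  IsRoot⁻-vanishing R (drop‿+<+ M²<4AC) (IsRoot⇒IsRoot⁻ R (suc A) m C root)
  where
  M²<4AC : + (suc m ℕ.* suc m) < + (4 ℕ.* suc A ℕ.* C)
  M²<4AC = ≡.subst (+ (suc m ℕ.* suc m) <_) (≡.sym (pos-* (4 ℕ.* suc A) C)) (i-j<0⇒i<j disc)

vanishing-polynomial : ∀ {r ℓ} (R : CommutativeRing r ℓ) a b c {γ} → a ≢ + 0 →
                       b * b - (+ 4 * a) * c < + 0 → IsRoot R a b c γ →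
                       Σ (List ℕ) (Rep R γ (CommutativeRing.0# R))
vanishing-polynomial R (+ zero) _ _ a≢0 = ⊥-elim (a≢0 ≡.refl)
vanishing-polynomial R +[1+ A ] b c _ disc root = vanishing-positive R A b c disc root
vanishing-polynomial R -[1+ A ] b c _ disc root =
  vanishing-positive R A (ℤ.- b) (ℤ.- c)
    (≡.subst (_< + 0) (≡.sym (discriminant-neg -[1+ A ] b c)) disc) (IsRoot-neg R -[1+ A ] b c root)

proposition9 : ∀ {c ℓ} (R : CommutativeRing c ℓ) (a b c' : ℤ) (β : CommutativeRing.Carrier R)
    → a ≢ + 0
    → (b * b) - ((+ 4) * a) * c' < + 0
    → IsRoot R a b c' β
    → Σ (List ℕ) (Rep R β (CommutativeRing.0# R))
      × InfinitelyMany (Rep R β (CommutativeRing.0# R))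
      × ((α : CommutativeRing.Carrier R) → Σ (List ℕ) (Rep R β α) → InfinitelyMany (Rep R β α))
proposition9 R a b c' β a≢0 disc root =
  zero-rep , Rep-infinitelyMany R zero-rep zero-rep , λ α → Rep-infinitelyMany R zero-rep
  where
  zero-rep : Σ (List ℕ) (Rep R β (CommutativeRing.0# R))
  zero-rep = vanishing-polynomial R a b c' a≢0 disc root
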